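{- Let $\mathbf{D}$ be a double Boolean algebra, and let $\mathcal{D}$, $\mathcal{D}_\sqcap$, $\mathcal{D}_\sqcup$ and the maps $r,e,r',e'$ be as described below. Then $r\circ e=\mathrm{id}_{\mathcal{D}_\sqcap}$, $r'\circ e'=\mathrm{id}_{\mathcal{D}_\sqcup}$, and (1) $e\circ r\circ e'\circ r'=e'\circ r'\circ e\circ r$; (2) for all $a,b\in\mathcal{D}$: $e\big(r(a)\wedge_B r(e'(r'(a)\vee_B r'(b)))\big)=e(r(a))$ and $e'\big(r'(a)\vee_B r'(e(r(a)\wedge_B r(b)))\big)=e'(r'(a))$, where $\wedge_B$ is the meet of $\mathcal{D}_\sqcap$ and $\vee_B$ the join of $\mathcal{D}_\sqcup$.
   Context: For an algebra $(D;\sqcap,\sqcup,\neg,\lrcorner,\top,\bot)$ of type $(2,2,1,1,0,0)$ write $x\vee y:=\neg(\neg x\sqcap\neg y)$, $x\wedge y:=\lrcorner(\lrcorner x\sqcup\lrcorner y)$. A double Boolean algebra (dBa) is such an algebra satisfying, for all $x,y,z$: $(x\sqcap x)\sqcap y=x\sqcap y$; $(x\sqcup x)\sqcup y=x\sqcup y$; $x\sqcap y=y\sqcap x$; $x\sqcup y=y\sqcup x$; $\neg(x\sqcap x)=\neg x$; $\lrcorner(x\sqcup x)=\lrcorner x$; $x\sqcap(x\sqcup y)=x\sqcap x$; $x\sqcup(x\sqcap y)=x\sqcup x$; $x\sqcap(y\vee z)=(x\sqcap y)\vee(x\sqcap z)$; $x\sqcup(y\wedge z)=(x\sqcup y)\wedge(x\sqcup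 z)$; $x\sqcap(x\vee y)=x\sqcap x$; $x\sqcup(x\wedge y)=x\sqcup x$; $\neg\neg(x\sqcap y)=x\sqcap y$; $\lrcorner\lrcorner(x\sqcup y)=x\sqcup y$; $x\sqcap\neg x=\bot$; $x\sqcup\lrcorner x=\top$; $\neg\top=\bot$; $\lrcorner\bot=\top$; $x\sqcap(y\sqcap z)=(x\sqcap y)\sqcap z$; $x\sqcup(y\sqcup z)=(x\sqcup y)\sqcup z$; $\neg\bot=\top\sqcap\top$; $\lrcorner\top=\bot\sqcup\bot$; $(x\sqcap x)\sqcup(x\sqcap x)=(x\sqcup x)\sqcap(x\sqcup x)$. Put $x\sqsubseteq y$ iff $x\sqcap y=x\sqcap x$ and $x\sqcup y=y\sqcup y$. A filter is $F\subseteq D$ closed under $\sqcap$ and upward closed w.r.t. $\sqsubseteq$; an ideal is $I\subseteq D$ closed under $\sqcup$ and downward closed w.r.t. $\sqsubseteq$. Primary filter: nonempty filter $F\neq D$ with $x\in F$ or $\neg x\in F$ for all $x$; primary ideal: nonempty ideal $I\ne D$ with $x\in I$ or $\lrcorner x\in I$ for all $x$. $F_x$ is the set of primary filters containing $x$ and $I_x$ the set of primary ideals containing $x$. $\mathcal{D}=\{(F_x,I_x)\mid x\in D\}$; $\mathcal{D}_\sqcap=\{(F_x,I_{x\sqcap x})\mid x\in D\}$, a Boolean algebra with meet $(F_x,I_{x\sqcap x})\wedge_B(F_y,I_{y\sqcap y})=(F_{x\sqcap y},I_{x\sqcap y})$, join $(F_{x\vee y},I_{x\vee y})$, complement $(F_{\neg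 x},I_{\neg x})$ and bottom $(F_\bot,I_\bot)$; $\mathcal{D}_\sqcup=\{(F_{x\sqcup x},I_x)\mid x\in D\}$, a Boolean algebra with join $(F_{x\sqcup x},I_x)\vee_B(F_{y\sqcup y},I_y)=(F_{x\sqcup y},I_{x\sqcup y})$, meet $(F_{x\wedge y},I_{x\wedge y})$, complement $(F_{\lrcorner x},I_{\lrcorner x})$ and top $(F_\top,I_\top)$. Maps: $r:\mathcal{D}\to\mathcal{D}_\sqcap$, $(F_x,I_x)\mapsto(F_x,I_{x\sqcap x})$; $e:\mathcal{D}_\sqcap\to\mathcal{D}$, $(F_x,I_{x\sqcap x})\mapsto(F_{x\sqcap x},I_{x\sqcap x})$; $r':\mathcal{D}\to\mathcal{D}_\sqcup$, $(F_x,I_x)\mapsto(F_{x\sqcup x},I_x)$; $e':\mathcal{D}_\sqcup\to\mathcal{D}$, $(F_{x\sqcup x},I_x)\mapsto(F_{x\sqcup x},I_{x\sqcup x})$. -}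

module Defs where

open import Level using (Level; suc)
open import Relation.Binary.PropositionalEquality using (_≡_)
open import Relation.Unary using (Pred; _∈_)
open import Relation.Nullary using (¬_)
open import Data.Product using (_×_; ∃; _,_)
open import Data.Sum using (_⊎_)
open import Function.Bundles using (_⇔_)

record DBA (a : Level) : Set (suc a) where
  field
    Carrier : Set a
    _⊓_ _⊔_ : Carrier → Carrier → Carrier
    neg lneg : Carrier → Carrier
    top bot : Carrier

  _∨_ : Carrier → Carrier → Carrier
  x ∨ y = neg (neg x ⊓ neg y)

  _∧_ : Carrier → Carrier → Carrier
  x ∧ y = lneg (lneg x ⊔ lneg y)

  field
    ax1a : ∀ x y → (x ⊓ x) ⊓ y ≡ x ⊓ y
    ax1b : ∀ x y → (x ⊔ x) ⊔ y ≡ x ⊔ y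
    ax2a : ∀ x y → x ⊓ y ≡ y ⊓ x
    ax2b : ∀ x y → x ⊔ y ≡ y ⊔ x
    ax3a : ∀ x → neg (x ⊓ x) ≡ neg x
    ax3b : ∀ x → lneg (x ⊔ x) ≡ lneg x
    ax4a : ∀ x y → x ⊓ (x ⊔ y) ≡ x ⊓ x
    ax4b : ∀ x y → x ⊔ (x ⊓ y) ≡ x ⊔ x
    ax5a : ∀ x y z → x ⊓ (y ∨ z) ≡ (x ⊓ y) ∨ (x ⊓ z)
    ax5b : ∀ x y z → x ⊔ (y ∧ z) ≡ (x ⊔ y) ∧ (x ⊔ z)
    ax6a : ∀ x y → x ⊓ (x ∨ y) ≡ x ⊓ x
    ax6b : ∀ x y → x ⊔ (x ∧ y) ≡ x ⊔ x
    ax7a : ∀ x y → neg (neg (x ⊓ y)) ≡ x ⊓ y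
    ax7b : ∀ x y → lneg (lneg (x ⊔ y)) ≡ x ⊔ y
    ax8a : ∀ x → x ⊓ neg x ≡ bot
    ax8b : ∀ x → x ⊔ lneg x ≡ top
    ax9a : neg top ≡ bot
    ax9b : lneg bot ≡ top
    ax10a : ∀ x y z → x ⊓ (y ⊓ z) ≡ (x ⊓ y) ⊓ z
    ax10b : ∀ x y z → x ⊔ (y ⊔ z) ≡ (x ⊔ y) ⊔ z
    ax11a : neg bot ≡ top ⊓ top
    ax11b : lneg top ≡ bot ⊔ bot
    ax12 : ∀ x → (x ⊓ x) ⊔ (x ⊓ x) ≡ (x ⊔ x) ⊓ (x ⊔ x)

  _⊑_ : Carrier → Carrier → Set a
  x ⊑ y = (x ⊓ y ≡ x ⊓ x) × (x ⊔ y ≡ y ⊔ y)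

  Subset : Set (suc a)
  Subset = Pred Carrier a

  IsFilter : Subset → Set a
  IsFilter F = (∀ {x y} → x ∈ F → y ∈ F → (x ⊓ y) ∈ F)
             × (∀ {x y} → x ∈ F → x ⊑ y → y ∈ F)

  IsIdeal : Subset → Set a
  IsIdeal I = (∀ {x y} → x ∈ I → y ∈ I → (x ⊔ y) ∈ I)
            × (∀ {x y} → x ∈ I → y ⊑ x → y ∈ I)

  IsPrimaryFilter : Subset → Set a
  IsPrimaryFilter F = IsFilter F × (∃ λ x → x ∈ F) × (¬ (∀ x → x ∈ F))
                    × (∀ x → x ∈ F ⊎ neg x ∈ F)

  IsPrimaryIdeal : Subset → Set a
  IsPrimaryIdeal I = IsIdeal I × (∃ λ x → x ∈ I) × (¬ (∀ x → x ∈ I))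
                   × (∀ x → x ∈ I ⊎ lneg x ∈ I)

  Fx : Carrier → Pred Subset a
  Fx x F = IsPrimaryFilter F × x ∈ F

  Ix : Carrier → Pred Subset a
  Ix x I = IsPrimaryIdeal I × x ∈ I

  record Pair : Set (suc a) where
    eta-equality
    constructor ⟨_,_⟩
    field
      fst snd : Pred Subset a

  _≐_ : Pair → Pair → Set (suc a)
  p ≐ q = (∀ S → (Pair.fst p S ⇔ Pair.fst q S)) × (∀ S → (Pair.snd p S ⇔ Pair.snd q S))

  -- Elements of 𝒟, 𝒟⊓, 𝒟⊔ are given by representatives x ∈ D;
  -- the element itself is the pair it denotes.
  record 𝒟 : Set a where
    eta-equality
    constructor mk
    field rep : Carrier

  record 𝒟⊓ : Set a where
    eta-equality
    constructor mk⊓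
    field rep : Carrier

  record 𝒟⊔ : Set a where
    eta-equality
    constructor mk⊔
    field rep : Carrier

  ⟦_⟧ : 𝒟 → Pair
  ⟦ mk x ⟧ = ⟨ Fx x , Ix x ⟩

  ⟦_⟧⊓ : 𝒟⊓ → Pair
  ⟦ mk⊓ x ⟧⊓ = ⟨ Fx x , Ix (x ⊓ x) ⟩

  ⟦_⟧⊔ : 𝒟⊔ → Pair
  ⟦ mk⊔ x ⟧⊔ = ⟨ Fx (x ⊔ x) , Ix x ⟩

  _≈_ : 𝒟 → 𝒟 → Set (suc a)
  u ≈ v = ⟦ u ⟧ ≐ ⟦ v ⟧

  _≈⊓_ : 𝒟⊓ → 𝒟⊓ → Set (suc a)
  u ≈⊓ v = ⟦ u ⟧⊓ ≐ ⟦ v ⟧⊓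

  _≈⊔_ : 𝒟⊔ → 𝒟⊔ → Set (suc a)
  u ≈⊔ v = ⟦ u ⟧⊔ ≐ ⟦ v ⟧⊔

  _∧B_ : 𝒟⊓ → 𝒟⊓ → 𝒟⊓
  mk⊓ x ∧B mk⊓ y = mk⊓ (x ⊓ y)

  _∨B_ : 𝒟⊔ → 𝒟⊔ → 𝒟⊔
  mk⊔ x ∨B mk⊔ y = mk⊔ (x ⊔ y)

  r : 𝒟 → 𝒟⊓
  r (mk x) = mk⊓ x

  e : 𝒟⊓ → 𝒟
  e (mk⊓ x) = mk (x ⊓ x)

  r' : 𝒟 → 𝒟⊔
  r' (mk x) = mk⊔ x

  e' : 𝒟⊔ → 𝒟
  e' (mk⊔ x) = mk (x ⊔ x)

{-# OPTIONS --safe #-}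
module Submission where

open import Defs
open import Level using (Level)
open import Data.Product using (_×_; _,_; proj₁)
open import Function using (_∘_)
open import Function.Bundles using (_⇔_; mk⇔; module Equivalence)
import Function.Properties.Equivalence as ⇔
open import Relation.Unary using (_∈_)
open import Relation.Binary.PropositionalEquality using (_≡_; refl; sym; trans; cong; module ≡-Reasoning)

-- Each claim reduces to an equation between representatives, except where x ⊓ x (dually
-- x ⊔ x) replaces x: these may differ in D, yet lie in the same primary filters (ideals),
-- since filters are ⊓-closed and x ⊓ x ⊑ x.  Part (1) is then axiom 12, and part (2) is the
-- absorption law x ⊓ ((x ⊔ y) ⊔ (x ⊔ y)) = x ⊓ x and its dual.

module _ {a : Level} (D : DBA a) where
  open DBA D

  ⊓-square-idem : ∀ x → (x ⊓ x) ⊓ (x ⊓ x) ≡ x ⊓ x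
  ⊓-square-idem x = begin
    (x ⊓ x) ⊓ (x ⊓ x)  ≡⟨ ax1a x (x ⊓ x) ⟩
    x ⊓ (x ⊓ x)        ≡⟨ ax2a x (x ⊓ x) ⟩
    (x ⊓ x) ⊓ x        ≡⟨ ax1a x x ⟩
    x ⊓ x              ∎
    where open ≡-Reasoning

  ⊔-square-idem : ∀ x → (x ⊔ x) ⊔ (x ⊔ x) ≡ x ⊔ x
  ⊔-square-idem x = begin
    (x ⊔ x) ⊔ (x ⊔ x)  ≡⟨ ax1b x (x ⊔ x) ⟩
    x ⊔ (x ⊔ x)        ≡⟨ ax2b x (x ⊔ x) ⟩
    (x ⊔ x) ⊔ x        ≡⟨ ax1b x x ⟩
    x ⊔ x              ∎
    where open ≡-Reasoning

  ⊓-square-⊑ : ∀ x → (x ⊓ x) ⊑ x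
  ⊓-square-⊑ x = trans (ax1a x x) (sym (⊓-square-idem x))
               , trans (ax2b (x ⊓ x) x) (ax4b x x)

  ⊑-⊔-square : ∀ x → x ⊑ (x ⊔ x)
  ⊑-⊔-square x = ax4a x x
               , trans (ax2b x (x ⊔ x)) (trans (ax1b x x) (sym (⊔-square-idem x)))

  filter-∈-⊓-square : ∀ {F x} → IsFilter F → (x ⊓ x) ∈ F ⇔ x ∈ F
  filter-∈-⊓-square {x = x} (⊓-closed , ⊑-closed) =
    mk⇔ (λ x⊓x∈F → ⊑-closed x⊓x∈F (⊓-square-⊑ x)) (λ x∈F → ⊓-closed x∈F x∈F)

  ideal-∈-⊔-square : ∀ {I x} → IsIdeal I → (x ⊔ x) ∈ I ⇔ x ∈ I
  ideal-∈-⊔-square {x = x} (⊔-closed , ⊑-closed) =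
    mk⇔ (λ x⊔x∈I → ⊑-closed x⊔x∈I (⊑-⊔-square x)) (λ x∈I → ⊔-closed x∈I x∈I)

  Fx-⊓-square : ∀ x S → Fx (x ⊓ x) S ⇔ Fx x S
  Fx-⊓-square x S =
    mk⇔ (λ (primary , x⊓x∈S) → primary , Equivalence.to (filter-∈-⊓-square (proj₁ primary)) x⊓x∈S)
        (λ (primary , x∈S) → primary , Equivalence.from (filter-∈-⊓-square (proj₁ primary)) x∈S)

  Ix-⊔-square : ∀ x S → Ix (x ⊔ x) S ⇔ Ix x S
  Ix-⊔-square x S =
    mk⇔ (λ (primary , x⊔x∈S) → primary , Equivalence.to (ideal-∈-⊔-square (proj₁ primary)) x⊔x∈S)
        (λ (primary , x∈S) → primary , Equivalence.from (ideal-∈-⊔-square (proj₁ primary)) x∈S)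

  Ix-cong : ∀ {x y} → x ≡ y → ∀ S → Ix x S ⇔ Ix y S
  Ix-cong refl S = ⇔.refl

  Fx-cong : ∀ {x y} → x ≡ y → ∀ S → Fx x S ⇔ Fx y S
  Fx-cong refl S = ⇔.refl

  mk-cong : ∀ {x y} → x ≡ y → mk x ≈ mk y
  mk-cong x≡y = Fx-cong x≡y , Ix-cong x≡y

  ⊓-absorbs-⊔-square : ∀ x y → x ⊓ ((x ⊔ y) ⊔ (x ⊔ y)) ≡ x ⊓ x
  ⊓-absorbs-⊔-square x y = trans (cong (x ⊓_) (sym (ax10b x y (x ⊔ y)))) (ax4a x (y ⊔ (x ⊔ y)))

  ⊔-absorbs-⊓-square : ∀ x y → x ⊔ ((x ⊓ y) ⊓ (x ⊓ y)) ≡ x ⊔ x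
  ⊔-absorbs-⊓-square x y = trans (cong (x ⊔_) (sym (ax10a x y (x ⊓ y)))) (ax4b x (y ⊓ (x ⊓ y)))

  r∘e≈id : ∀ u → r (e u) ≈⊓ u
  r∘e≈id (mk⊓ x) = Fx-⊓-square x , Ix-cong (⊓-square-idem x)

  r'∘e'≈id : ∀ u → r' (e' u) ≈⊔ u
  r'∘e'≈id (mk⊔ x) = Fx-cong (⊔-square-idem x) , Ix-⊔-square x

  e∘r∘e'∘r'≈e'∘r'∘e∘r : ∀ u → (e ∘ r ∘ e' ∘ r') u ≈ (e' ∘ r' ∘ e ∘ r) u
  e∘r∘e'∘r'≈e'∘r'∘e∘r (mk x) = mk-cong (sym (ax12 x))

  e∘r-absorbs-e'∘r' : ∀ u v → e (r u ∧B r (e' (r' u ∨B r' v))) ≈ e (r u)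
  e∘r-absorbs-e'∘r' (mk x) (mk y) =
    mk-cong (trans (cong (λ t → t ⊓ t) (⊓-absorbs-⊔-square x y)) (⊓-square-idem x))

  e'∘r'-absorbs-e∘r : ∀ u v → e' (r' u ∨B r' (e (r u ∧B r v))) ≈ e' (r' u)
  e'∘r'-absorbs-e∘r (mk x) (mk y) =
    mk-cong (trans (cong (λ t → t ⊔ t) (⊔-absorbs-⊓-square x y)) (⊔-square-idem x))

proposition4p13 : ∀ {a : Level} (D : DBA a) → let open DBA D in
    (∀ u → r (e u) ≈⊓ u)
    × (∀ u → r' (e' u) ≈⊔ u)
    × (∀ a₀ → (e ∘ r ∘ e' ∘ r') a₀ ≈ (e' ∘ r' ∘ e ∘ r) a₀)
    × (∀ a₀ b₀ → e (r a₀ ∧B r (e' (r' a₀ ∨B r' b₀))) ≈ e (r a₀))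
    × (∀ a₀ b₀ → e' (r' a₀ ∨B r' (e (r a₀ ∧B r b₀))) ≈ e' (r' a₀))
proposition4p13 D = r∘e≈id D
                  , r'∘e'≈id D
                  , e∘r∘e'∘r'≈e'∘r'∘e∘r D
                  , e∘r-absorbs-e'∘r' D
                  , e'∘r'-absorbs-e∘r D
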